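{- Let $H$ be a $2$-connected graph. Then $c'(H)=c(H)$.
   Context: All graphs are finite and simple. For a graph $G$, $v(G)$ and $e(G)$ denote its numbers of vertices and edges. A graph $H$ is a minor of $G$ if a graph isomorphic to $H$ can be obtained from a subgraph of $G$ by contracting edges. For a graph $H$ with $v(H)\ge 2$, $c(H)$ is the supremum of $e(G)/v(G)$ over all non-null graphs $G$ not containing $H$ as a minor. For a graph $H$ with $v(H)\ge 3$, $c'(H)$ is the supremum of $e(G)/(v(G)-1)$ over all graphs $G$ with $v(G)>1$ not containing $H$ as a minor. -}

module Defs where

open import Data.Nat using (ℕ; zero; suc; _+_; _*_; _∸_; _≤_; _<_; _≥_; _<ᵇ_)
open import Data.Bool using (Bool; true; false; _∧_; if_then_else_)
open import Data.Fin using (Fin; toℕ)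
open import Data.List using (List; map; allFin)
open import Data.Nat.ListAction using (sum)
open import Data.Maybe using (Maybe; just; nothing)
open import Data.Product using (Σ; ∃; ∃-syntax; _×_; _,_)
open import Relation.Binary.PropositionalEquality using (_≡_; _≢_)
open import Relation.Nullary using (¬_)

record Graph : Set where
  field
    n     : ℕ
    adj   : Fin n → Fin n → Bool
    adj-sym  : ∀ i j → adj i j ≡ adj j i
    adj-irr  : ∀ i → adj i i ≡ false
open Graph public

v : Graph → ℕ
v G = n G

E : (G : Graph) → Fin (n G) → Fin (n G) → Set
E G i j = adj G i j ≡ true

e : Graph → ℕ
e G = sum (map (λ i → sum (map (λ j → if (toℕ j <ᵇ toℕ i) ∧ adj G i j then 1 else 0)
                                 (allFin (n G))))
               (allFin (n G)))

data Walk (G : Graph) (P : Fin (n G) → Set) : Fin (n G) → Fin (n G) → Set where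
  stop : ∀ {x} → P x → Walk G P x x
  step : ∀ {x y z} → P x → E G x y → Walk G P y z → Walk G P x z

Connected : Graph → Set
Connected G = (1 ≤ n G) × (∀ x y → Walk G (λ _ → ⊤′) x y)
  where
    open import Data.Unit using () renaming (⊤ to ⊤′)

TwoConnected : Graph → Set
TwoConnected G =
  (3 ≤ n G) × Connected G ×
  (∀ (w x y : Fin (n G)) → x ≢ w → y ≢ w → Walk G (λ u → u ≢ w) x y)

-- A minor model of H in G (branch sets): each vertex of G is assigned to at
-- most one vertex of H (so branch sets are disjoint); each branch set is
-- non-empty and induces a connected subgraph of G; every edge of H is
-- realised by an edge of G between the corresponding branch sets.
record MinorModel (H G : Graph) : Set where
  field
    branch    : Fin (n G) → Maybe (Fin (n H))
    nonempty  : ∀ h → ∃[ g ] branch g ≡ just h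
    connected : ∀ h g g' → branch g ≡ just h → branch g' ≡ just h →
                Walk G (λ u → branch u ≡ just h) g g'
    edges     : ∀ h h' → E H h h' →
                ∃[ g ] ∃[ g' ] (branch g ≡ just h × branch g' ≡ just h' × E G g g')

IsMinor : Graph → Graph → Set
IsMinor H G = MinorModel H G

-- The nonnegative rational a/(suc b) is an upper bound for
-- { e(G)/v(G) : G non-null, no H minor }, i.e.  c(H) ≤ a/(b+1).
cUB : Graph → ℕ → ℕ → Set
cUB H a b = ∀ (G : Graph) → 1 ≤ v G → ¬ IsMinor H G → e G * suc b ≤ a * v G

-- a/(suc b) is an upper bound for
-- { e(G)/(v(G)-1) : v(G) > 1, no H minor }, i.e.  c'(H) ≤ a/(b+1).
c'UB : Graph → ℕ → ℕ → Set
c'UB H a b = ∀ (G : Graph) → 2 ≤ v G → ¬ IsMinor H G → e G * suc b ≤ a * (v G ∸ 1)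

{-# OPTIONS --safe #-}
-- A 2-connected minor of a 1-sum lies in one of the two summands: a branch set
-- avoiding the shared vertex is connected without it, so it stays on one side,
-- and since H stays connected after deleting the (at most one) vertex whose branch
-- set contains the shared vertex, adjacency drags all branch sets to the same side.
-- Hence gluing k copies of an H-minor-free graph G at one common vertex stays
-- H-minor-free; it has k·e(G) edges and 1 + k·(v(G) − 1) vertices.  For k = a + 1
-- the bound e ≤ a/(b+1) · v on this graph reads
--   (a+1)·e(G)·(b+1) ≤ a + (a+1)·a·(v(G) − 1),
-- and as the leftover a is smaller than the factor a + 1, cancelling it gives
-- e(G)·(b+1) ≤ a·(v(G) − 1).
module Submission where

open import Defs
open import Data.Bool using (Bool; true; false; _∧_; if_then_else_)
open import Data.Empty using (⊥-elim)
open import Data.Fin using (Fin; zero; suc; toℕ; _↑ˡ_; _↑ʳ_; splitAt)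
open import Data.Fin.Properties
  using (_≟_; ↑ˡ-injective; ↑ʳ-injective; toℕ-↑ˡ; splitAt-↑ˡ; splitAt-↑ʳ; splitAt⁻¹-↑ˡ; splitAt⁻¹-↑ʳ)
open import Data.List using (map; tabulate)
open import Data.Maybe using (Maybe; just; nothing)
open import Data.Maybe.Properties using (just-injective)
import Data.Maybe.Properties as Maybe
open import Data.Nat using (ℕ; zero; suc; _+_; _*_; _≤_; _<ᵇ_; z≤n; s≤s; s≤s⁻¹)
open import Data.Nat.Properties
  using (+-0-monoid; +-identityʳ; +-assoc; +-comm; *-assoc; *-suc; *-cancelˡ-<; +-monoˡ-<; n<1+n;
         n≤1+n; <⇒≤; ≤-trans; *-monoʳ-≤; module ≤-Reasoning)
import Data.Nat.ListAction as List
open import Data.Nat.Tactic.RingSolver using (solve-∀)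
open import Data.Product using (∃; _×_; _,_; proj₁; proj₂)
open import Data.Sum using (_⊎_; inj₁; inj₂; [_,_]′; swap)
open import Function using (_∘_; id)
open import Relation.Nullary using (¬_; does; yes; no)
open import Relation.Nullary.Decidable using (dec-true)
open import Relation.Binary.PropositionalEquality
open import Algebra.Properties.Monoid.Sum +-0-monoid using (sum; sum-cong-≗; sum-replicate-zero)

E-sym : (G : Graph) {x y : Fin (n G)} → E G x y → E G y x
E-sym G {x} {y} = trans (adj-sym G y x)

E-irrefl : (G : Graph) {x : Fin (n G)} → ¬ E G x x
E-irrefl G {x} p with () ← trans (sym (adj-irr G x)) p

Walk-head : ∀ {G P x y} → Walk G P x y → P x
Walk-head (stop px)     = px
Walk-head (step px _ _) = px

-- G is (a spanning subgraph of) the 1-sum of G₁ and G₂: copies of them meeting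
-- in the single vertex ι₁ cut₁ = ι₂ cut₂, with no other edges between the sides.
record OneSum (G G₁ G₂ : Graph) : Set where
  field
    ι₁           : Fin (n G₁) → Fin (n G)
    ι₂           : Fin (n G₂) → Fin (n G)
    cut₁         : Fin (n G₁)
    cut₂         : Fin (n G₂)
    ι-cut        : ι₁ cut₁ ≡ ι₂ cut₂
    ι₁-injective : ∀ {a b} → ι₁ a ≡ ι₁ b → a ≡ b
    ι₂-injective : ∀ {a b} → ι₂ a ≡ ι₂ b → a ≡ b
    ι-overlap    : ∀ {a b} → ι₁ a ≡ ι₂ b → a ≡ cut₁
    ι-cover      : ∀ x → (∃ λ a → ι₁ a ≡ x) ⊎ (∃ λ b → ι₂ b ≡ x)
    E-ι₁         : ∀ {a b} → E G (ι₁ a) (ι₁ b) → E G₁ a b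
    E-ι₂         : ∀ {a b} → E G (ι₂ a) (ι₂ b) → E G₂ a b
    E-cross      : ∀ {a b} → E G (ι₁ a) (ι₂ b) → a ≡ cut₁ ⊎ b ≡ cut₂

  cut : Fin (n G)
  cut = ι₁ cut₁

OneSum-swap : ∀ {G G₁ G₂} → OneSum G G₁ G₂ → OneSum G G₂ G₁
OneSum-swap {G} S = record
  { ι₁ = ι₂ ; ι₂ = ι₁ ; cut₁ = cut₂ ; cut₂ = cut₁ ; ι-cut = sym ι-cut
  ; ι₁-injective = ι₂-injective ; ι₂-injective = ι₁-injective
  ; ι-overlap = λ e → ι₂-injective (trans e (trans (cong ι₁ (ι-overlap (sym e))) ι-cut))
  ; ι-cover = swap ∘ ι-cover
  ; E-ι₁ = E-ι₂ ; E-ι₂ = E-ι₁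
  ; E-cross = swap ∘ E-cross ∘ E-sym G
  }
  where open OneSum S

module _ {G G₁ G₂ : Graph} (S : OneSum G G₁ G₂) where
  open OneSum S

  E-from-side₁ : ∀ {a x} → E G (ι₁ a) x → (∃ λ a' → ι₁ a' ≡ x) ⊎ a ≡ cut₁
  E-from-side₁ {x = x} e with ι-cover x
  ... | inj₁ side₁ = inj₁ side₁
  ... | inj₂ (b , refl) with E-cross e
  ...   | inj₁ a≡cut₁ = inj₂ a≡cut₁
  ...   | inj₂ refl   = inj₁ (cut₁ , ι-cut)

  -- A walk ending on side 1 projects to G₁, as its excursions into side 2 leave
  -- and re-enter through the cut vertex.
  mutual
    walk-side₁ : ∀ {P x y g g'} → Walk G P x y → ι₁ g ≡ x → ι₁ g' ≡ y → Walk G₁ (P ∘ ι₁) g g'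
    walk-side₁ (stop px) refl eq = subst (Walk G₁ _ _) (sym (ι₁-injective eq)) (stop px)
    walk-side₁ (step {y = y} px e w) refl eq with ι-cover y
    ... | inj₁ (a , refl) = step px (E-ι₁ e) (walk-side₁ w refl eq)
    ... | inj₂ (b , refl) with E-cross e
    ...   | inj₁ refl = proj₂ (walk-via-cut w refl eq)
    ...   | inj₂ refl = step px (E-ι₁ (subst (E G _) (sym ι-cut) e)) (walk-side₁ w ι-cut eq)

    walk-via-cut : ∀ {P x y g₂ g'} → Walk G P x y → ι₂ g₂ ≡ x → ι₁ g' ≡ y →
                   P cut × Walk G₁ (P ∘ ι₁) cut₁ g'
    walk-via-cut {P} (stop px) refl eq with refl ← ι-overlap eq =
      subst P (sym eq) px , stop (subst P (sym eq) px)
    walk-via-cut {P} (step {y = y} px e w) refl eq with ι-cover y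
    ... | inj₂ (b , refl) = walk-via-cut w refl eq
    ... | inj₁ (a , refl) with E-cross (E-sym G e)
    ...   | inj₁ refl = Walk-head w , walk-side₁ w refl eq
    ...   | inj₂ refl = pcut , step pcut (E-ι₁ (subst (λ z → E G z _) (sym ι-cut) e)) (walk-side₁ w refl eq)
      where
        pcut : P cut
        pcut = subst P (sym ι-cut) px

module _ {G G₁ G₂ : Graph} (S : OneSum G G₁ G₂) {H : Graph} (M : MinorModel H G) where
  open OneSum S
  open MinorModel M

  AvoidsCut : Fin (n H) → Set
  AvoidsCut h = branch cut ≢ just h

  MeetsSide₁ : Fin (n H) → Set
  MeetsSide₁ h = ∃ λ a → branch (ι₁ a) ≡ just h

  branch-within-side₁ : ∀ {h x} → AvoidsCut h → MeetsSide₁ h → branch x ≡ just h → ∃ λ a → ι₁ a ≡ x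
  branch-within-side₁ {h} {x} avoid (a , ba) bx with ι-cover x
  ... | inj₁ side₁ = side₁
  ... | inj₂ (b , refl) = ⊥-elim (avoid (proj₁ (walk-via-cut S (connected h x (ι₁ a) bx ba) refl refl)))

  meetsSide₁-E : ∀ {h h'} → AvoidsCut h → E H h h' → MeetsSide₁ h → MeetsSide₁ h'
  meetsSide₁-E {h} {h'} avoid ehh' meets with edges h h' ehh'
  ... | x , x' , bx , bx' , exx' with branch-within-side₁ avoid meets bx
  ... | a , refl with E-from-side₁ S exx'
  ...   | inj₁ (a' , refl) = a' , bx'
  ...   | inj₂ refl        = ⊥-elim (avoid bx)

  meetsSide₁-walk : ∀ {R h h'} → Walk H R h h' → (∀ {z} → R z → AvoidsCut z) → MeetsSide₁ h → MeetsSide₁ h'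
  meetsSide₁-walk (stop _)     _     meets = meets
  meetsSide₁-walk (step r e w) avoid meets = meetsSide₁-walk w avoid (meetsSide₁-E (avoid r) e meets)

  meetsSide₁-all : TwoConnected H → ∀ {h} → AvoidsCut h → MeetsSide₁ h →
                   ∀ h' → AvoidsCut h' → MeetsSide₁ h'
  meetsSide₁-all (_ , (_ , walk) , walk-avoiding) {h} avoid meets h' avoid' with branch cut in bcut
  ... | nothing = meetsSide₁-walk (walk h h') (λ _ b → nothing≢just (trans (sym bcut) b)) meets
    where
      nothing≢just : ∀ {z} → nothing ≢ just z
      nothing≢just ()
  ... | just h₀ =
    meetsSide₁-walk (walk-avoiding h₀ h h' (avoid ∘ cong just ∘ sym) (avoid' ∘ cong just ∘ sym))
                    (λ z≢h₀ b → z≢h₀ (just-injective (trans (sym b) bcut))) meets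

  E-avoidsCut : ∀ {h h'} → E H h h' → AvoidsCut h ⊎ AvoidsCut h'
  E-avoidsCut {h} {h'} ehh' with Maybe.≡-dec _≟_ (branch cut) (just h')
  ... | no avoid' = inj₂ avoid'
  ... | yes bc    = inj₁ λ bc' → E-irrefl H (subst (E H h) (just-injective (trans (sym bc) bc')) ehh')

  restrict₁ : (∀ h → AvoidsCut h → MeetsSide₁ h) → MinorModel H G₁
  restrict₁ meets = record
    { branch    = branch ∘ ι₁
    ; nonempty  = nonempty₁
    ; connected = λ h a a' ba ba' → walk-side₁ S (connected h (ι₁ a) (ι₁ a') ba ba') refl refl
    ; edges     = edges₁
    }
    where
      nonempty₁ : ∀ h → ∃ λ a → branch (ι₁ a) ≡ just h
      nonempty₁ h with Maybe.≡-dec _≟_ (branch cut) (just h)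
      ... | yes bc    = cut₁ , bc
      ... | no avoid  = meets h avoid

      realise₁ : ∀ {h h' x x'} → branch x ≡ just h → branch x' ≡ just h' → E G x x' → AvoidsCut h' →
                 ∃ λ a → ∃ λ a' → branch (ι₁ a) ≡ just h × branch (ι₁ a') ≡ just h' × E G₁ a a'
      realise₁ {h' = h'} bx bx' exx' avoid' with branch-within-side₁ avoid' (meets h' avoid') bx'
      ... | a' , refl with E-from-side₁ S (E-sym G exx')
      ...   | inj₁ (a , refl) = a , a' , bx , bx' , E-ι₁ exx'
      ...   | inj₂ refl       = ⊥-elim (avoid' bx')

      edges₁ : ∀ h h' → E H h h' →
               ∃ λ a → ∃ λ a' → branch (ι₁ a) ≡ just h × branch (ι₁ a') ≡ just h' × E G₁ a a'
      edges₁ h h' ehh' with edges h h' ehh' | E-avoidsCut ehh'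
      ... | x , x' , bx , bx' , exx' | inj₂ avoid' = realise₁ bx bx' exx' avoid'
      ... | x , x' , bx , bx' , exx' | inj₁ avoid with realise₁ bx' bx (E-sym G exx') avoid
      ...   | a' , a , ba' , ba , e = a , a' , ba , ba' , E-sym G₁ e

∃-≢-just : ∀ {k} → 2 ≤ k → (mb : Maybe (Fin k)) → ∃ λ h → mb ≢ just h
∃-≢-just (s≤s (s≤s _)) nothing         = zero , λ ()
∃-≢-just (s≤s (s≤s _)) (just zero)     = suc zero , λ ()
∃-≢-just (s≤s (s≤s _)) (just (suc _)) = zero , λ ()

minor-in-summand : ∀ {G G₁ G₂ H} → OneSum G G₁ G₂ → TwoConnected H →
                   MinorModel H G → MinorModel H G₁ ⊎ MinorModel H G₂
minor-in-summand {G} {G₁} {G₂} S TC@(3≤v , _) M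
  with ∃-≢-just (<⇒≤ 3≤v) (MinorModel.branch M (OneSum.cut S))
... | h , avoid with MinorModel.nonempty M h
... | x , bx with OneSum.ι-cover S x
... | inj₁ (a , refl) = inj₁ (restrict₁ S M (meetsSide₁-all S M TC avoid (a , bx)))
... | inj₂ (b , refl) =
  inj₂ (restrict₁ S' M (meetsSide₁-all S' M TC (avoid ∘ trans (cong branch ι-cut)) (b , bx)))
  where
    open MinorModel M
    open OneSum S
    S' : OneSum G G₂ G₁
    S' = OneSum-swap S

indicator : Bool → ℕ
indicator b = if b then 1 else 0

sum-map-tabulate : ∀ {A : Set} {k} (f : A → ℕ) (g : Fin k → A) →
                   List.sum (map f (tabulate g)) ≡ sum (f ∘ g)
sum-map-tabulate {k = zero}  f g = refl
sum-map-tabulate {k = suc k} f g = cong (f (g zero) +_) (sum-map-tabulate f (g ∘ suc))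

sum-split : ∀ k l (f : Fin (k + l) → ℕ) → sum f ≡ sum (f ∘ (_↑ˡ l)) + sum (f ∘ (k ↑ʳ_))
sum-split zero    l f = refl
sum-split (suc k) l f = trans (cong (f zero +_) (sum-split k l (f ∘ suc))) (sym (+-assoc (f zero) _ _))

sum-indicator-≟ : ∀ {k} (c : Fin k) b → sum (λ i → indicator (does (i ≟ c) ∧ b)) ≡ indicator b
sum-indicator-≟ {suc k} zero    b = trans (cong (indicator b +_) (sum-replicate-zero k)) (+-identityʳ _)
sum-indicator-≟ {suc k} (suc c) b = sum-indicator-≟ c b

↑ˡ<ᵇ↑ʳ : ∀ {k l} (i : Fin k) (j : Fin l) → (toℕ (i ↑ˡ l) <ᵇ toℕ (k ↑ʳ j)) ≡ true
↑ˡ<ᵇ↑ʳ zero    j = refl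
↑ˡ<ᵇ↑ʳ (suc i) j = ↑ˡ<ᵇ↑ʳ i j

↑ʳ<ᵇ↑ˡ : ∀ {k l} (j : Fin l) (i : Fin k) → (toℕ (k ↑ʳ j) <ᵇ toℕ (i ↑ˡ l)) ≡ false
↑ʳ<ᵇ↑ˡ j zero    = refl
↑ʳ<ᵇ↑ˡ j (suc i) = ↑ʳ<ᵇ↑ˡ j i

↑ʳ<ᵇ↑ʳ : ∀ k {l} (j j' : Fin l) → (toℕ (k ↑ʳ j) <ᵇ toℕ (k ↑ʳ j')) ≡ (toℕ j <ᵇ toℕ j')
↑ʳ<ᵇ↑ʳ zero    j j' = refl
↑ʳ<ᵇ↑ʳ (suc k) j j' = ↑ʳ<ᵇ↑ʳ k j j'

↑ˡ≢↑ʳ : ∀ {k l} (i : Fin k) (j : Fin l) → i ↑ˡ l ≢ k ↑ʳ j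
↑ˡ≢↑ʳ {k} {l} i j e
  with () ← trans (sym (splitAt-↑ˡ k i l)) (trans (cong (splitAt k) e) (splitAt-↑ʳ k l j))

entry : (G : Graph) → Fin (n G) → Fin (n G) → ℕ
entry G i j = indicator ((toℕ j <ᵇ toℕ i) ∧ adj G i j)

row : (G : Graph) → Fin (n G) → ℕ
row G i = sum (entry G i)

e≡sum-row : ∀ G → e G ≡ sum (row G)
e≡sum-row G = trans (sum-map-tabulate (λ i → List.sum (map (entry G i) (tabulate id))) id)
                    (sum-cong-≗ λ i → sum-map-tabulate (entry G i) id)

-- The graph on Fin (suc m) given by a₂ is glued to G₁ by identifying its vertex
-- zero with c; its vertex suc j becomes n G₁ ↑ʳ j.
module OneSumAt (G₁ : Graph) (c : Fin (n G₁)) {m : ℕ} (a₂ : Fin (suc m) → Fin (suc m) → Bool)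
                (a₂-sym : ∀ i j → a₂ i j ≡ a₂ j i) (a₂-irr : ∀ i → a₂ i i ≡ false) where

  G₂ : Graph
  G₂ = record { n = suc m ; adj = a₂ ; adj-sym = a₂-sym ; adj-irr = a₂-irr }

  private
    n₁ : ℕ
    n₁ = n G₁

  adj⊎ : Fin n₁ ⊎ Fin m → Fin n₁ ⊎ Fin m → Bool
  adj⊎ (inj₁ i) (inj₁ i') = adj G₁ i i'
  adj⊎ (inj₁ i) (inj₂ j)  = does (i ≟ c) ∧ a₂ zero (suc j)
  adj⊎ (inj₂ j) (inj₁ i)  = does (i ≟ c) ∧ a₂ (suc j) zero
  adj⊎ (inj₂ j) (inj₂ j') = a₂ (suc j) (suc j')

  adj⊎-sym : ∀ x y → adj⊎ x y ≡ adj⊎ y x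
  adj⊎-sym (inj₁ i) (inj₁ i') = adj-sym G₁ i i'
  adj⊎-sym (inj₁ i) (inj₂ j)  = cong (does (i ≟ c) ∧_) (a₂-sym zero (suc j))
  adj⊎-sym (inj₂ j) (inj₁ i)  = cong (does (i ≟ c) ∧_) (a₂-sym (suc j) zero)
  adj⊎-sym (inj₂ j) (inj₂ j') = a₂-sym (suc j) (suc j')

  adj⊎-irr : ∀ x → adj⊎ x x ≡ false
  adj⊎-irr (inj₁ i) = adj-irr G₁ i
  adj⊎-irr (inj₂ j) = a₂-irr (suc j)

  glued : Graph
  glued = record
    { n       = n₁ + m
    ; adj     = λ x y → adj⊎ (splitAt n₁ x) (splitAt n₁ y)
    ; adj-sym = λ x y → adj⊎-sym (splitAt n₁ x) (splitAt n₁ y)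
    ; adj-irr = λ x → adj⊎-irr (splitAt n₁ x)
    }

  adj-↑ˡ↑ˡ : ∀ i i' → adj glued (i ↑ˡ m) (i' ↑ˡ m) ≡ adj G₁ i i'
  adj-↑ˡ↑ˡ i i' = cong₂ adj⊎ (splitAt-↑ˡ n₁ i m) (splitAt-↑ˡ n₁ i' m)

  adj-↑ˡ↑ʳ : ∀ i j → adj glued (i ↑ˡ m) (n₁ ↑ʳ j) ≡ (does (i ≟ c) ∧ a₂ zero (suc j))
  adj-↑ˡ↑ʳ i j = cong₂ adj⊎ (splitAt-↑ˡ n₁ i m) (splitAt-↑ʳ n₁ m j)

  adj-↑ʳ↑ˡ : ∀ j i → adj glued (n₁ ↑ʳ j) (i ↑ˡ m) ≡ (does (i ≟ c) ∧ a₂ (suc j) zero)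
  adj-↑ʳ↑ˡ j i = cong₂ adj⊎ (splitAt-↑ʳ n₁ m j) (splitAt-↑ˡ n₁ i m)

  adj-↑ʳ↑ʳ : ∀ j j' → adj glued (n₁ ↑ʳ j) (n₁ ↑ʳ j') ≡ a₂ (suc j) (suc j')
  adj-↑ʳ↑ʳ j j' = cong₂ adj⊎ (splitAt-↑ʳ n₁ m j) (splitAt-↑ʳ n₁ m j')

  ι₂ : Fin (suc m) → Fin (n₁ + m)
  ι₂ zero    = c ↑ˡ m
  ι₂ (suc j) = n₁ ↑ʳ j

  adj-ι₂ : ∀ a b → adj glued (ι₂ a) (ι₂ b) ≡ a₂ a b
  adj-ι₂ zero    zero     = trans (adj-↑ˡ↑ˡ c c) (trans (adj-irr G₁ c) (sym (a₂-irr zero)))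
  adj-ι₂ zero    (suc j)  = trans (adj-↑ˡ↑ʳ c j) (cong (_∧ a₂ zero (suc j)) (dec-true (c ≟ c) refl))
  adj-ι₂ (suc j) zero     = trans (adj-↑ʳ↑ˡ j c) (cong (_∧ a₂ (suc j) zero) (dec-true (c ≟ c) refl))
  adj-ι₂ (suc j) (suc j') = adj-↑ʳ↑ʳ j j'

  ι₂-injective : ∀ {a b} → ι₂ a ≡ ι₂ b → a ≡ b
  ι₂-injective {zero}  {zero}   _ = refl
  ι₂-injective {zero}  {suc j}  e = ⊥-elim (↑ˡ≢↑ʳ c j e)
  ι₂-injective {suc j} {zero}   e = ⊥-elim (↑ˡ≢↑ʳ c j (sym e))
  ι₂-injective {suc j} {suc j'} e = cong suc (↑ʳ-injective n₁ j j' e)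

  ι-overlap : ∀ {a b} → a ↑ˡ m ≡ ι₂ b → a ≡ c
  ι-overlap {a} {zero}  e = ↑ˡ-injective m a c e
  ι-overlap {a} {suc j} e = ⊥-elim (↑ˡ≢↑ʳ a j e)

  ι-cover : ∀ x → (∃ λ a → a ↑ˡ m ≡ x) ⊎ (∃ λ b → ι₂ b ≡ x)
  ι-cover x with splitAt n₁ x in eq
  ... | inj₁ i = inj₁ (i , splitAt⁻¹-↑ˡ eq)
  ... | inj₂ j = inj₂ (suc j , splitAt⁻¹-↑ʳ eq)

  E-cross : ∀ {a b} → E glued (a ↑ˡ m) (ι₂ b) → a ≡ c ⊎ b ≡ zero
  E-cross {a} {zero}  _ = inj₂ refl
  E-cross {a} {suc j} e with a ≟ c | trans (sym (adj-↑ˡ↑ʳ a j)) e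
  ... | yes a≡c | _ = inj₁ a≡c
  ... | no _    | ()

  oneSum : OneSum glued G₁ G₂
  oneSum = record
    { ι₁ = _↑ˡ m ; ι₂ = ι₂ ; cut₁ = c ; cut₂ = zero ; ι-cut = refl
    ; ι₁-injective = ↑ˡ-injective m _ _ ; ι₂-injective = ι₂-injective
    ; ι-overlap = λ {a} {b} → ι-overlap {a} {b} ; ι-cover = ι-cover
    ; E-ι₁ = λ {a} {b} → trans (sym (adj-↑ˡ↑ˡ a b))
    ; E-ι₂ = λ {a} {b} → trans (sym (adj-ι₂ a b))
    ; E-cross = E-cross
    }

  entry-↑ˡ↑ˡ : ∀ i i' → entry glued (i ↑ˡ m) (i' ↑ˡ m) ≡ entry G₁ i i'
  entry-↑ˡ↑ˡ i i' = cong indicator (cong₂ _∧_ (cong₂ _<ᵇ_ (toℕ-↑ˡ i' m) (toℕ-↑ˡ i m)) (adj-↑ˡ↑ˡ i i'))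

  entry-↑ˡ↑ʳ : ∀ i j → entry glued (i ↑ˡ m) (n₁ ↑ʳ j) ≡ 0
  entry-↑ˡ↑ʳ i j = cong (λ b → indicator (b ∧ adj glued (i ↑ˡ m) (n₁ ↑ʳ j))) (↑ʳ<ᵇ↑ˡ j i)

  entry-↑ʳ↑ˡ : ∀ j i → entry glued (n₁ ↑ʳ j) (i ↑ˡ m) ≡ indicator (does (i ≟ c) ∧ a₂ (suc j) zero)
  entry-↑ʳ↑ˡ j i = cong indicator (cong₂ _∧_ (↑ˡ<ᵇ↑ʳ i j) (adj-↑ʳ↑ˡ j i))

  entry-↑ʳ↑ʳ : ∀ j j' → entry glued (n₁ ↑ʳ j) (n₁ ↑ʳ j') ≡ entry G₂ (suc j) (suc j')
  entry-↑ʳ↑ʳ j j' = cong indicator (cong₂ _∧_ (↑ʳ<ᵇ↑ʳ n₁ j' j) (adj-↑ʳ↑ʳ j j'))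

  row-↑ˡ : ∀ i → row glued (i ↑ˡ m) ≡ row G₁ i
  row-↑ˡ i = begin
    row glued (i ↑ˡ m)
      ≡⟨ sum-split n₁ m _ ⟩
    sum (entry glued (i ↑ˡ m) ∘ (_↑ˡ m)) + sum (entry glued (i ↑ˡ m) ∘ (n₁ ↑ʳ_))
      ≡⟨ cong₂ _+_ (sum-cong-≗ (entry-↑ˡ↑ˡ i))
                   (trans (sum-cong-≗ (entry-↑ˡ↑ʳ i)) (sum-replicate-zero m)) ⟩
    row G₁ i + 0
      ≡⟨ +-identityʳ _ ⟩
    row G₁ i ∎
    where open ≡-Reasoning

  -- The edge from n₁ ↑ʳ j to c is counted in this row, as the edge from suc j to zero is in G₂.
  row-↑ʳ : ∀ j → row glued (n₁ ↑ʳ j) ≡ row G₂ (suc j)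
  row-↑ʳ j = begin
    row glued (n₁ ↑ʳ j)
      ≡⟨ sum-split n₁ m _ ⟩
    sum (entry glued (n₁ ↑ʳ j) ∘ (_↑ˡ m)) + sum (entry glued (n₁ ↑ʳ j) ∘ (n₁ ↑ʳ_))
      ≡⟨ cong₂ _+_ (trans (sum-cong-≗ (entry-↑ʳ↑ˡ j)) (sum-indicator-≟ c _))
                   (sum-cong-≗ (entry-↑ʳ↑ʳ j)) ⟩
    row G₂ (suc j) ∎
    where open ≡-Reasoning

  e-glued : e glued ≡ e G₁ + e G₂
  e-glued = begin
    e glued
      ≡⟨ e≡sum-row glued ⟩
    sum (row glued)
      ≡⟨ sum-split n₁ m _ ⟩
    sum (row glued ∘ (_↑ˡ m)) + sum (row glued ∘ (n₁ ↑ʳ_))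
      ≡⟨ cong₂ _+_ (sum-cong-≗ row-↑ˡ) (sum-cong-≗ row-↑ʳ) ⟩
    sum (row G₁) + sum (row G₂ ∘ suc)
      ≡⟨ cong₂ _+_ (e≡sum-row G₁) e₂ ⟨
    e G₁ + e G₂ ∎
    where
      open ≡-Reasoning
      e₂ : e G₂ ≡ sum (row G₂ ∘ suc)
      e₂ = trans (e≡sum-row G₂) (cong (_+ sum (row G₂ ∘ suc)) (sum-replicate-zero (suc m)))

module Bouquet {m : ℕ} (a : Fin (suc m) → Fin (suc m) → Bool)
               (a-sym : ∀ i j → a i j ≡ a j i) (a-irr : ∀ i → a i i ≡ false) where

  G : Graph
  G = record { n = suc m ; adj = a ; adj-sym = a-sym ; adj-irr = a-irr }

  mutual
    bouquet : ℕ → Graph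
    bouquet zero    = G
    bouquet (suc k) = OneSumAt.glued (bouquet k) (root k) a a-sym a-irr

    root : (k : ℕ) → Fin (n (bouquet k))
    root zero    = zero
    root (suc k) = root k ↑ˡ m

  v-bouquet : ∀ k → v (bouquet k) ≡ suc (suc k * m)
  v-bouquet zero    = cong suc (sym (+-identityʳ m))
  v-bouquet (suc k) = trans (cong (_+ m) (v-bouquet k)) (cong suc (+-comm (suc k * m) m))

  e-bouquet : ∀ k → e (bouquet k) ≡ suc k * e G
  e-bouquet zero    = sym (+-identityʳ (e G))
  e-bouquet (suc k) = begin
    e (bouquet (suc k))     ≡⟨ OneSumAt.e-glued (bouquet k) (root k) a a-sym a-irr ⟩
    e (bouquet k) + e G     ≡⟨ cong (_+ e G) (e-bouquet k) ⟩
    suc k * e G + e G       ≡⟨ +-comm (suc k * e G) (e G) ⟩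
    suc (suc k) * e G       ∎
    where open ≡-Reasoning

  bouquet-minorFree : ∀ {H} → TwoConnected H → ¬ IsMinor H G → ∀ k → ¬ IsMinor H (bouquet k)
  bouquet-minorFree TC free zero    = free
  bouquet-minorFree TC free (suc k) =
    [ bouquet-minorFree TC free k , free ]′
    ∘ minor-in-summand (OneSumAt.oneSum (bouquet k) (root k) a a-sym a-irr) TC

[1+a]*x≤a+[1+a]*y⇒x≤y : ∀ a x y → suc a * x ≤ a + suc a * y → x ≤ y
[1+a]*x≤a+[1+a]*y⇒x≤y a x y p = s≤s⁻¹ (*-cancelˡ-< (suc a) x (suc y) (begin-strict
  suc a * x           ≤⟨ p ⟩
  a + suc a * y       <⟨ +-monoˡ-< (suc a * y) (n<1+n a) ⟩
  suc a + suc a * y   ≡⟨ *-suc (suc a) y ⟨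
  suc a * suc y       ∎))
  where open ≤-Reasoning

cUB⇒c'UB : (H : Graph) → TwoConnected H → (a b : ℕ) → cUB H a b → c'UB H a b
cUB⇒c'UB H TC a b bound record { n = zero } ()
cUB⇒c'UB H TC a b bound record { n = suc m ; adj = adjG ; adj-sym = adjG-sym ; adj-irr = adjG-irr } _ free =
  [1+a]*x≤a+[1+a]*y⇒x≤y a (e G * suc b) (a * m) (begin
    suc a * (e G * suc b)         ≡⟨ *-assoc (suc a) (e G) (suc b) ⟨
    suc a * e G * suc b           ≡⟨ cong (_* suc b) (e-bouquet a) ⟨
    e (bouquet a) * suc b         ≤⟨ bound (bouquet a) (subst (1 ≤_) (sym (v-bouquet a)) (s≤s z≤n))
                                               (bouquet-minorFree TC free a) ⟩
    a * v (bouquet a)             ≡⟨ cong (a *_) (v-bouquet a) ⟩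
    a * suc (suc a * m)           ≡⟨ distribute a m ⟩
    a + suc a * (a * m)           ∎)
  where
    open Bouquet adjG adjG-sym adjG-irr
    open ≤-Reasoning
    distribute : ∀ a m → a * suc (suc a * m) ≡ a + suc a * (a * m)
    distribute = solve-∀

c'UB⇒cUB : (H : Graph) → (a b : ℕ) → c'UB H a b → cUB H a b
c'UB⇒cUB H a b bound record { n = zero } ()
c'UB⇒cUB H a b bound record { n = suc zero } _ _ = z≤n
c'UB⇒cUB H a b bound G@record { n = suc (suc m) } _ free =
  ≤-trans (bound G (s≤s (s≤s z≤n)) free) (*-monoʳ-≤ a (n≤1+n (suc m)))

lemma2p2 : (H : Graph) → TwoConnected H →
    (a b : ℕ) → (cUB H a b → c'UB H a b) × (c'UB H a b → cUB H a b)
lemma2p2 H TC a b = cUB⇒c'UB H TC a b , c'UB⇒cUB H a b
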